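{- Suppose in round $t$ the bidder bids $\mathbf b=\langle(b_1,q_1),\dots,(b_m,q_m)\rangle$, let $Q_j=\sum_{\ell=1}^jq_\ell$ ($Q_0=0$), and let $\boldsymbol\beta^t=(\mathbf b;\boldsymbol\beta_-^t)$ be the bid profile. Then the per-unit price satisfies $$p(\boldsymbol\beta^t)=\begin{cases}0,& x(\boldsymbol\beta^t)=0,\\ b_\ell,& Q_{\ell-1}<x(\boldsymbol\beta^t)<Q_\ell,\\ \min\big(b_\ell,\beta_-^{t,-(Q_\ell+1)}\big),& x(\boldsymbol\beta^t)=Q_\ell,\end{cases}$$ for $\ell\in[m]$.
   Context: A uniform price auction sells $K$ identical units. An $m$-uniform strategy $\langle(b_1,q_1),\dots,(b_m,q_m)\rangle$ has $b_1>\dots>b_m>0$ and positive integers $q_j$, and stands for the bid vector with $q_1$ copies of $b_1$, then $q_2$ copies of $b_2$, etc. Given competing bids $\boldsymbol\beta_-^t$ (bids of all other bidders in round $t$), all bids are sorted and the $K$ highest bids win one unit each (ties broken in favor of the bidder); $x(\boldsymbol\beta^t)$ is the bidder's number of winning bids and $p(\boldsymbol\beta^t)$ is the per-unit price, equal to the $K$-th highest submitted bid when $x\ge1$. $\beta_-^{t,-(j)}$ denotes the $j$-th smallest among the top $K$ competing bids in round $t$, with conventions $\beta_-^{t,-(0)}=0$ and $\beta_-^{t,-(j)}=\infty$ for $j>K$.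
   Formalization: The bid values b_ℓ and the competing bids $\boldsymbol\beta_-^t$ are taken in ℚ. -}

module Defs where

open import Data.Nat as ℕ using (ℕ; zero; suc; _+_; _∸_)
open import Data.Fin as Fin using (Fin; toℕ)
open import Data.List as List using (List; []; _∷_; _++_; length; replicate; concatMap; reverse; take; filter)
open import Data.Nat.ListAction using (sum)
open import Data.Rational as ℚ using (ℚ; _⊓_; 0ℚ)
open import Data.Rational.Properties as ℚP using (≤-decTotalOrder; _<?_)
open import Relation.Nullary.Decidable using (does; yes; no)
open import Data.Bool using (if_then_else_)
import Data.List.Sort as Sort
open Sort ≤-decTotalOrder using (sort)

-- Extended rationals ℚ ∪ {∞} (for the convention β^{-(j)} = ∞ when j > K).
data ℚ∞ : Set where
  fin : ℚ → ℚ∞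
  ∞   : ℚ∞

min∞ : ℚ∞ → ℚ∞ → ℚ∞
min∞ (fin a) (fin b) = fin (a ⊓ b)
min∞ x       ∞       = x
min∞ ∞       y       = y

sortDesc : List ℚ → List ℚ
sortDesc xs = reverse (sort xs)

-- 0-indexed lookup with default 0 (only used at indices known to be in range).
nth : ℕ → List ℚ → ℚ
nth _       []       = 0ℚ
nth zero    (x ∷ xs) = x
nth (suc n) (x ∷ xs) = nth n xs

-- An m-uniform strategy: prices b : Fin m → ℚ and quantities q : Fin m → ℕ
-- (index j : Fin m stands for the paper's index j+1).
StrictlyDecreasing : {m : ℕ} → (Fin m → ℚ) → Set
StrictlyDecreasing b = ∀ i j → i Fin.< j → b j ℚ.< b i

bidVector : {m : ℕ} → (Fin m → ℚ) → (Fin m → ℕ) → List ℚ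
bidVector b q = concatMap (λ j → replicate (q j) (b j)) (List.allFin _)

Qsum : {m : ℕ} → (Fin m → ℕ) → ℕ → ℕ
Qsum q j = sum (take j (List.tabulate q))

numAbove : ℚ → List ℚ → ℕ
numAbove c comp = length (filter (λ d → c <? d) comp)

-- Allocation with ties broken in favour of the bidder: the bidder's i-th
-- highest bid c_i (i ≥ 1) has rank i + #{competing bids > c_i} in the overall
-- sorted order, and wins iff that rank is ≤ K.
winsFrom : (K : ℕ) → List ℚ → ℕ → List ℚ → ℕ
winsFrom K comp i []       = 0
winsFrom K comp i (c ∷ cs) =
  (if does ((i + numAbove c comp) ℕ.≤? K) then 1 else 0) + winsFrom K comp (suc i) cs

allocation : (K : ℕ) → (own comp : List ℚ) → ℕ
allocation K own comp = winsFrom K comp 1 own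

-- K-th highest submitted bid (K ≥ 1 assumed when used).
kthHighest : (K : ℕ) → List ℚ → ℚ
kthHighest K xs = nth (K ∸ 1) (sortDesc xs)

price : (K : ℕ) → (own comp : List ℚ) → ℚ
price K own comp with allocation K own comp
... | zero  = 0ℚ
... | suc _ = kthHighest K (own ++ comp)

-- β_-^{-(j)}: j-th smallest among the top K competing bids,
-- with β^{-(0)} = 0 and β^{-(j)} = ∞ for j > K.
-- For 1 ≤ j ≤ K this is the (K - j + 1)-th highest competing bid.
compMinus : (K : ℕ) → List ℚ → ℕ → ℚ∞
compMinus K comp zero = fin 0ℚ
compMinus K comp (suc j) with suc j ℕ.≤? K
... | yes _ = fin (nth (K ∸ suc j) (sortDesc comp))
... | no  _ = ∞

-- Ranks are read off from counts: in a descending list the entry at position i is v exactly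
-- when at most i entries exceed v and more than i entries are at least v.  The bidder's winning
-- bids form a prefix of its descending bid vector, so with x wins the x-th bid v = b_ℓ passes the
-- rank test i + #{competing bids > c} ≤ K and the (x+1)-th fails it.  Counting own and competing
-- bids above and at v then identifies the K-th highest bid: strictly inside a block the next own
-- bid is again v, which forces the price to be v; at the end of a block the competing bid of rank
-- K - x, i.e. β^{-(x+1)}, can undercut b_ℓ, which produces the minimum.
module Submission where

open import Defs
open import Data.Nat as ℕ using (ℕ; zero; suc; _+_; _∸_; _≤_; _<_; z≤n; s≤s)
import Data.Nat.Properties as ℕP
open import Data.List as List using (List; []; _∷_; _++_; length; filter; reverse; replicate)
import Data.List.Properties as ListP
open import Data.List.Relation.Unary.All as All using (All; []; _∷_)
import Data.List.Relation.Unary.All.Properties as AllP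
import Data.List.Relation.Unary.Any.Properties as AnyP
open import Data.List.Relation.Unary.AllPairs using (AllPairs; []; _∷_)
import Data.List.Relation.Unary.AllPairs.Properties as AllPairsP
import Data.List.Relation.Unary.Linked.Properties as LinkedP
open import Data.List.Relation.Binary.Permutation.Propositional using (_↭_; ↭-trans)
import Data.List.Relation.Binary.Permutation.Propositional.Properties as PermP
open import Data.Rational as ℚ using (ℚ; 0ℚ)
open import Data.Fin as Fin using (Fin; toℕ)
import Data.Rational.Properties as ℚP
open import Data.Product using (_×_; _,_)
open import Data.Empty using (⊥-elim)
open import Relation.Nullary using (¬_; yes; no; contradiction)
open import Relation.Nullary.Decidable using (dec-true; dec-false)
open import Data.Bool using (if_then_else_)
open import Relation.Unary using (Pred; Decidable)
open import Relation.Binary.Definitions using (tri<; tri≈; tri>)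
open import Relation.Binary.PropositionalEquality
open import Level using (0ℓ)
open import Function using (_∘_; id)
import Data.List.Sort as Sort
open Sort ℚP.≤-decTotalOrder using (sort; sort-↭; sort-↗)

count : {A : Set} {P : Pred A 0ℓ} → Decidable P → List A → ℕ
count P? xs = length (filter P? xs)

module _ {A : Set} {P : Pred A 0ℓ} (P? : Decidable P) where

  count-accept : ∀ {x} xs → P x → count P? (x ∷ xs) ≡ suc (count P? xs)
  count-accept xs px = cong length (ListP.filter-accept P? px)

  count-reject : ∀ {x} xs → ¬ P x → count P? (x ∷ xs) ≡ count P? xs
  count-reject xs ¬px = cong length (ListP.filter-reject P? ¬px)

  count-++ : ∀ xs ys → count P? (xs ++ ys) ≡ count P? xs + count P? ys
  count-++ xs ys = trans (cong length (ListP.filter-++ P? xs ys)) (ListP.length-++ (filter P? xs))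

  count-↭ : ∀ {xs ys} → xs ↭ ys → count P? xs ≡ count P? ys
  count-↭ p = PermP.↭-length (PermP.filter-↭ P? p)

count-mono : {A : Set} {P Q : Pred A 0ℓ} (P? : Decidable P) (Q? : Decidable Q) →
  (∀ {x} → P x → Q x) → ∀ xs → count P? xs ≤ count Q? xs
count-mono P? Q? P⇒Q [] = z≤n
count-mono P? Q? P⇒Q (x ∷ xs) with P? x | Q? x
... | yes _ | yes _ = s≤s (count-mono P? Q? P⇒Q xs)
... | yes p | no ¬q = ⊥-elim (¬q (P⇒Q p))
... | no _  | yes _ = ℕP.m≤n⇒m≤1+n (count-mono P? Q? P⇒Q xs)
... | no _  | no _  = count-mono P? Q? P⇒Q xs

Descending : List ℚ → Set
Descending = AllPairs (λ x y → y ℚ.≤ x)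

UpwardClosed : Pred ℚ 0ℓ → Set
UpwardClosed P = ∀ {x y} → P x → x ℚ.≤ y → P y

All-nth : ∀ {Q : Pred ℚ 0ℓ} {xs} → All Q xs → ∀ {a} → a < length xs → Q (nth a xs)
All-nth (qx ∷ _)  {zero}  _         = qx
All-nth (_  ∷ qs) {suc a} (s≤s a<n) = All-nth qs a<n

module _ {P : Pred ℚ 0ℓ} (P? : Decidable P) (up : UpwardClosed P) where

  -- In a descending list an upward-closed predicate holds exactly on a prefix.
  index<count : ∀ {xs} → Descending xs → ∀ {a} → a < length xs → P (nth a xs) → a < count P? xs
  index<count {x ∷ xs} _ {zero} _ px rewrite count-accept P? xs px = s≤s z≤n
  index<count {x ∷ xs} (x≥ ∷ desc) {suc a} (s≤s a<n) pa
    rewrite count-accept P? xs (up pa (All-nth x≥ a<n)) = s≤s (index<count desc a<n pa)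

  count≤index : ∀ {xs} → Descending xs → ∀ a → (a < length xs → ¬ P (nth a xs)) → count P? xs ≤ a
  count≤index {[]}     _            a       _  = z≤n
  count≤index {x ∷ xs} (x≥ ∷ desc) zero    ¬p rewrite count-reject P? xs (¬p (s≤s z≤n)) =
    count≤index desc zero (λ 0<n p → ¬p (s≤s z≤n) (up p (All-nth x≥ 0<n)))
  count≤index {x ∷ xs} (_  ∷ desc) (suc a) ¬p with P? x
  ... | yes _ = s≤s (count≤index desc a (¬p ∘ s≤s))
  ... | no _  = ℕP.m≤n⇒m≤1+n (count≤index desc a (¬p ∘ s≤s))

above? : (v : ℚ) → Decidable (v ℚ.<_)
above? v = v ℚP.<?_

atLeast? : (v : ℚ) → Decidable (v ℚ.≤_)
atLeast? v = v ℚP.≤?_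

<⇒≱ : ∀ {x y : ℚ} → x ℚ.< y → ¬ (y ℚ.≤ x)
<⇒≱ x<y y≤x = ℚP.<-irrefl refl (ℚP.<-≤-trans x<y y≤x)

module _ {ys} (desc : Descending ys) where

  count-above≤index : ∀ {i v} → nth i ys ≡ v → count (above? v) ys ≤ i
  count-above≤index {i} nth≡v = count≤index (above? _) ℚP.<-≤-trans desc i
    (λ _ v<nth → ℚP.<-irrefl (sym nth≡v) v<nth)

  index<count-atLeast : ∀ {i v} → i < length ys → nth i ys ≡ v → i < count (atLeast? v) ys
  index<count-atLeast i<n nth≡v = index<count (atLeast? _) ℚP.≤-trans desc i<n (ℚP.≤-reflexive (sym nth≡v))

  nth-by-counts : ∀ {i v} → count (above? v) ys ≤ i → i < count (atLeast? v) ys → nth i ys ≡ v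
  nth-by-counts {i} {v} above≤i i<atLeast with ℚP.<-cmp (nth i ys) v
  ... | tri≈ _ eq _ = eq
  ... | tri< w<v _ _ = ⊥-elim (ℕP.<⇒≱ i<atLeast
          (count≤index (atLeast? v) ℚP.≤-trans desc i (λ _ v≤w → <⇒≱ w<v v≤w)))
  ... | tri> _ _ v<w = ⊥-elim (ℕP.<⇒≱ (s≤s above≤i)
          (index<count (above? v) ℚP.<-≤-trans desc i<n v<w))
    where
    i<n : i < length ys
    i<n = ℕP.<-≤-trans i<atLeast (ListP.length-filter (atLeast? v) ys)

reverse-ascending : ∀ {xs} → AllPairs ℚ._≤_ xs → Descending (reverse xs)
reverse-ascending {[]}     []          = []
reverse-ascending {x ∷ xs} (x≤ ∷ asc) rewrite ListP.unfold-reverse x xs =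
  AllPairsP.++⁺ (reverse-ascending asc) ([] ∷ []) (All.tabulate (λ x∈ → All.lookup x≤ (AnyP.reverse⁻ x∈) ∷ []))

sortDesc-descending : ∀ xs → Descending (sortDesc xs)
sortDesc-descending xs = reverse-ascending (LinkedP.Linked⇒AllPairs ℚP.≤-trans (sort-↗ xs))

sortDesc-↭ : ∀ xs → sortDesc xs ↭ xs
sortDesc-↭ xs = ↭-trans (PermP.↭-reverse (sort xs)) (sort-↭ xs)

module _ (zs : List ℚ) where

  private
    count-sortDesc : ∀ {P : Pred ℚ 0ℓ} (P? : Decidable P) → count P? (sortDesc zs) ≡ count P? zs
    count-sortDesc P? = count-↭ P? (sortDesc-↭ zs)

  kthHighest-by-counts : ∀ {K' v} → count (above? v) zs ≤ K' → K' < count (atLeast? v) zs →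
                         kthHighest (suc K') zs ≡ v
  kthHighest-by-counts {K'} {v} above≤K' K'<atLeast = nth-by-counts (sortDesc-descending zs)
    (subst (_≤ K') (sym (count-sortDesc (above? v))) above≤K')
    (subst (K' <_) (sym (count-sortDesc (atLeast? v))) K'<atLeast)

  numAbove-nth-sortDesc≤ : ∀ r → numAbove (nth r (sortDesc zs)) zs ≤ r
  numAbove-nth-sortDesc≤ r = subst (_≤ r) (count-sortDesc (above? _))
    (count-above≤index (sortDesc-descending zs) refl)

  <count-atLeast-nth-sortDesc : ∀ {r} → r < length zs → r < count (atLeast? (nth r (sortDesc zs))) zs
  <count-atLeast-nth-sortDesc {r} r<n = subst (r <_) (count-sortDesc (atLeast? _))
    (index<count-atLeast (sortDesc-descending zs)
      (subst (r <_) (sym (PermP.↭-length (sortDesc-↭ zs))) r<n) refl)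

kthHighest-++-by-counts : ∀ own comp {K' v} →
  count (above? v) own + numAbove v comp ≤ K' →
  K' < count (atLeast? v) own + count (atLeast? v) comp →
  kthHighest (suc K') (own ++ comp) ≡ v
kthHighest-++-by-counts own comp {K'} {v} above≤K' K'<atLeast = kthHighest-by-counts (own ++ comp)
  (subst (_≤ K') (sym (count-++ (above? v) own comp)) above≤K')
  (subst (K' <_) (sym (count-++ (atLeast? v) own comp)) K'<atLeast)

numAbove-antitone : ∀ comp {c c'} → c' ℚ.≤ c → numAbove c comp ≤ numAbove c' comp
numAbove-antitone comp c'≤c = count-mono (above? _) (above? _) (ℚP.≤-<-trans c'≤c) comp

Wins : ℕ → List ℚ → ℕ → ℚ → Set
Wins K comp i c = i + numAbove c comp ≤ K

module _ {K : ℕ} {comp : List ℚ} where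

  winsFrom-accept : ∀ {i c} cs → Wins K comp i c → winsFrom K comp i (c ∷ cs) ≡ suc (winsFrom K comp (suc i) cs)
  winsFrom-accept {i} {c} cs wins =
    cong (λ b → (if b then 1 else 0) + winsFrom K comp (suc i) cs) (dec-true (_ ℕ.≤? K) wins)

  winsFrom-reject : ∀ {i c} cs → ¬ Wins K comp i c → winsFrom K comp i (c ∷ cs) ≡ winsFrom K comp (suc i) cs
  winsFrom-reject {i} {c} cs loses =
    cong (λ b → (if b then 1 else 0) + winsFrom K comp (suc i) cs) (dec-false (_ ℕ.≤? K) loses)

  winsFrom-after-loss : ∀ {i c} → ¬ Wins K comp i c → ∀ {cs} → All (ℚ._≤ c) cs →
                        ∀ {j} → i ≤ j → winsFrom K comp j cs ≡ 0
  winsFrom-after-loss loses {[]}     []          i≤j = refl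
  winsFrom-after-loss loses {c' ∷ cs} (c'≤c ∷ cs≤c) {j} i≤j
    with (j + numAbove c' comp) ℕ.≤? K
  ... | yes wins = ⊥-elim (loses (ℕP.≤-trans (ℕP.+-mono-≤ i≤j (numAbove-antitone comp c'≤c)) wins))
  ... | no loses' rewrite winsFrom-reject cs loses' = winsFrom-after-loss loses cs≤c (ℕP.m≤n⇒m≤1+n i≤j)

  winsFrom≤length : ∀ i cs → winsFrom K comp i cs ≤ length cs
  winsFrom≤length i []       = z≤n
  winsFrom≤length i (c ∷ cs) with (i + numAbove c comp) ℕ.≤? K
  ... | yes wins rewrite winsFrom-accept cs wins  = s≤s (winsFrom≤length (suc i) cs)
  ... | no loses rewrite winsFrom-reject cs loses = ℕP.m≤n⇒m≤1+n (winsFrom≤length (suc i) cs)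

  winsFrom-last-wins : ∀ {cs} → Descending cs → ∀ i w → winsFrom K comp i cs ≡ suc w →
                       Wins K comp (i + w) (nth w cs)
  winsFrom-last-wins {c ∷ cs} (c≥ ∷ desc) i w eq with (i + numAbove c comp) ℕ.≤? K
  ... | no loses = contradiction (trans (sym after-loss) (trans (sym (winsFrom-reject cs loses)) eq)) λ ()
    where
    after-loss : winsFrom K comp (suc i) cs ≡ 0
    after-loss = winsFrom-after-loss loses c≥ (ℕP.n≤1+n i)
  ... | yes wins with w | trans (sym (winsFrom-accept cs wins)) eq
  ... | zero   | _  = subst (λ j → Wins K comp j c) (sym (ℕP.+-identityʳ i)) wins
  ... | suc w' | eq' = subst (λ j → Wins K comp j (nth w' cs)) (sym (ℕP.+-suc i w'))
                         (winsFrom-last-wins desc (suc i) w' (ℕP.suc-injective eq'))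

  winsFrom-next-loses : ∀ {cs} → Descending cs → ∀ i → winsFrom K comp i cs < length cs →
                        ¬ Wins K comp (i + winsFrom K comp i cs) (nth (winsFrom K comp i cs) cs)
  winsFrom-next-loses {c ∷ cs} (c≥ ∷ desc) i w<n with (i + numAbove c comp) ℕ.≤? K
  ... | no loses rewrite winsFrom-reject cs loses | winsFrom-after-loss loses c≥ (ℕP.n≤1+n i) =
    subst (λ j → ¬ Wins K comp j c) (sym (ℕP.+-identityʳ i)) loses
  ... | yes wins rewrite winsFrom-accept cs wins =
    subst (λ j → ¬ Wins K comp j (nth (winsFrom K comp (suc i) cs) cs)) (sym (ℕP.+-suc i _))
      (winsFrom-next-loses desc (suc i) (ℕP.≤-pred w<n))

nth-++ˡ : ∀ xs ys {j} → j < length xs → nth j (xs ++ ys) ≡ nth j xs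
nth-++ˡ (x ∷ xs) ys {zero}  _         = refl
nth-++ˡ (x ∷ xs) ys {suc j} (s≤s j<n) = nth-++ˡ xs ys j<n

nth-++ʳ : ∀ xs ys j → nth (length xs + j) (xs ++ ys) ≡ nth j ys
nth-++ʳ []       ys j = refl
nth-++ʳ (x ∷ xs) ys j = nth-++ʳ xs ys j

nth-replicate : ∀ {n} x {j} → j < n → nth j (replicate n x) ≡ x
nth-replicate {suc n} x {zero}  _         = refl
nth-replicate {suc n} x {suc j} (s≤s j<n) = nth-replicate x j<n

Descending-replicate : ∀ n x → Descending (replicate n x)
Descending-replicate zero    x = []
Descending-replicate (suc n) x = AllP.replicate⁺ n ℚP.≤-refl ∷ Descending-replicate n x

module _ {m : ℕ} (b : Fin (suc m) → ℚ) (q : Fin (suc m) → ℕ) where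

  bidVector-suc : bidVector b q ≡ replicate (q Fin.zero) (b Fin.zero) ++ bidVector (b ∘ Fin.suc) (q ∘ Fin.suc)
  bidVector-suc = cong (λ xss → replicate (q Fin.zero) (b Fin.zero) ++ List.concat xss)
    (trans (ListP.map-tabulate Fin.suc block) (sym (ListP.map-tabulate id (block ∘ Fin.suc))))
    where
    block : Fin (suc m) → List ℚ
    block j = replicate (q j) (b j)

All-bidVector : ∀ {Q : Pred ℚ 0ℓ} {m} (b : Fin m → ℚ) q → (∀ j → Q (b j)) → All Q (bidVector b q)
All-bidVector {m = zero}  b q Qb = []
All-bidVector {m = suc m} b q Qb rewrite bidVector-suc b q =
  AllP.++⁺ (AllP.replicate⁺ (q Fin.zero) (Qb Fin.zero)) (All-bidVector (b ∘ Fin.suc) (q ∘ Fin.suc) (Qb ∘ Fin.suc))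

bidVector-descending : ∀ {m} (b : Fin m → ℚ) q → StrictlyDecreasing b → Descending (bidVector b q)
bidVector-descending {zero}  b q b↓ = []
bidVector-descending {suc m} b q b↓ rewrite bidVector-suc b q =
  AllPairsP.++⁺ (Descending-replicate (q Fin.zero) (b Fin.zero))
    (bidVector-descending (b ∘ Fin.suc) (q ∘ Fin.suc) (λ i j i<j → b↓ (Fin.suc i) (Fin.suc j) (s≤s i<j)))
    (AllP.replicate⁺ (q Fin.zero) (All-bidVector (b ∘ Fin.suc) (q ∘ Fin.suc)
      (λ j → ℚP.<⇒≤ (b↓ Fin.zero (Fin.suc j) (s≤s z≤n)))))

Qsum-suc : ∀ {m} (q : Fin m → ℕ) (ℓ : Fin m) → Qsum q (suc (toℕ ℓ)) ≡ Qsum q (toℕ ℓ) + q ℓ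
Qsum-suc q Fin.zero    = ℕP.+-identityʳ (q Fin.zero)
Qsum-suc q (Fin.suc ℓ) = trans (cong (q Fin.zero +_) (Qsum-suc (q ∘ Fin.suc) ℓ))
                               (sym (ℕP.+-assoc (q Fin.zero) _ _))

Qsum<Qsum-suc : ∀ {m} (q : Fin m → ℕ) → (∀ j → 1 ≤ q j) → ∀ ℓ → Qsum q (toℕ ℓ) < Qsum q (suc (toℕ ℓ))
Qsum<Qsum-suc q q≥1 ℓ = subst (Qsum q (toℕ ℓ) <_) (sym (Qsum-suc q ℓ)) (ℕP.m<m+n _ (q≥1 ℓ))

Qsum≤length-bidVector : ∀ {m} (b : Fin m → ℚ) q (ℓ : Fin m) → Qsum q (suc (toℕ ℓ)) ≤ length (bidVector b q)
Qsum≤length-bidVector {suc m} b q ℓ rewrite bidVector-suc b q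
  | ListP.length-++ (replicate (q Fin.zero) (b Fin.zero)) {bidVector (b ∘ Fin.suc) (q ∘ Fin.suc)}
  | ListP.length-replicate (q Fin.zero) {b Fin.zero} with ℓ
... | Fin.zero  = ℕP.+-monoʳ-≤ (q Fin.zero) z≤n
... | Fin.suc ℓ = ℕP.+-monoʳ-≤ (q Fin.zero) (Qsum≤length-bidVector (b ∘ Fin.suc) (q ∘ Fin.suc) ℓ)

nth-bidVector : ∀ {m} (b : Fin m → ℚ) q (ℓ : Fin m) {k} → k < q ℓ →
                nth (Qsum q (toℕ ℓ) + k) (bidVector b q) ≡ b ℓ
nth-bidVector {suc m} b q Fin.zero {k} k<q rewrite bidVector-suc b q =
  trans (nth-++ˡ (replicate (q Fin.zero) (b Fin.zero)) _ (subst (k <_) (sym (ListP.length-replicate (q Fin.zero))) k<q))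
        (nth-replicate (b Fin.zero) k<q)
nth-bidVector {suc m} b q (Fin.suc ℓ) {k} k<q rewrite bidVector-suc b q = begin
  nth (q₀ + Qsum (q ∘ Fin.suc) (toℕ ℓ) + k) (block₀ ++ rest)             ≡⟨ cong (λ i → nth i (block₀ ++ rest)) shift ⟩
  nth (length block₀ + (Qsum (q ∘ Fin.suc) (toℕ ℓ) + k)) (block₀ ++ rest) ≡⟨ nth-++ʳ block₀ rest _ ⟩
  nth (Qsum (q ∘ Fin.suc) (toℕ ℓ) + k) rest                               ≡⟨ nth-bidVector (b ∘ Fin.suc) (q ∘ Fin.suc) ℓ k<q ⟩
  b (Fin.suc ℓ)                                                            ∎
  where
  open ≡-Reasoning
  q₀ : ℕ
  q₀ = q Fin.zero

  block₀ rest : List ℚ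
  block₀ = replicate q₀ (b Fin.zero)
  rest = bidVector (b ∘ Fin.suc) (q ∘ Fin.suc)

  shift : q₀ + Qsum (q ∘ Fin.suc) (toℕ ℓ) + k ≡ length block₀ + (Qsum (q ∘ Fin.suc) (toℕ ℓ) + k)
  shift = trans (ℕP.+-assoc q₀ _ k) (cong (_+ _) (sym (ListP.length-replicate q₀)))

nth-bidVector-block : ∀ {m} (b : Fin m → ℚ) q (ℓ : Fin m) {j} →
  Qsum q (toℕ ℓ) ≤ j → j < Qsum q (suc (toℕ ℓ)) → nth j (bidVector b q) ≡ b ℓ
nth-bidVector-block b q ℓ {j} Q≤j j<Q′ = begin
  nth j (bidVector b q)                 ≡⟨ cong (λ i → nth i (bidVector b q)) (sym (ℕP.m+[n∸m]≡n Q≤j)) ⟩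
  nth (Q + (j ∸ Q)) (bidVector b q)     ≡⟨ nth-bidVector b q ℓ j∸Q<q ⟩
  b ℓ                                   ∎
  where
  open ≡-Reasoning
  Q : ℕ
  Q = Qsum q (toℕ ℓ)
  j∸Q<q : j ∸ Q < q ℓ
  j∸Q<q = subst (j ∸ Q <_) (ℕP.m+n∸m≡n Q (q ℓ)) (ℕP.∸-monoˡ-< (subst (j <_) (Qsum-suc q ℓ) j<Q′) Q≤j)

price-of-no-win : ∀ K own comp → allocation K own comp ≡ 0 → price K own comp ≡ 0ℚ
price-of-no-win K own comp x≡0 with allocation K own comp
... | zero = refl

price-of-win : ∀ K own comp {n} → allocation K own comp ≡ suc n → price K own comp ≡ kthHighest K (own ++ comp)
price-of-win K own comp x≡suc with allocation K own comp
... | suc _ = refl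

module _ {K' : ℕ} (comp : List ℚ) {own : List ℚ} (desc : Descending own) {x' : ℕ} {v : ℚ}
         (last≡v : nth x' own ≡ v) (wins : Wins (suc K') comp (suc x') v) where

  private
    above-own≤x' : count (above? v) own ≤ x'
    above-own≤x' = count-above≤index desc last≡v

    above≤K' : count (above? v) own + numAbove v comp ≤ K'
    above≤K' = ℕP.≤-trans (ℕP.+-monoˡ-≤ (numAbove v comp) above-own≤x') (ℕP.≤-pred wins)

    x'<atLeast-own : x' < length own → x' < count (atLeast? v) own
    x'<atLeast-own x'<n = index<count-atLeast desc x'<n last≡v

  kthHighest-interior : suc x' < length own → nth (suc x') own ≡ v →
    ¬ Wins (suc K') comp (suc (suc x')) v → kthHighest (suc K') (own ++ comp) ≡ v
  kthHighest-interior next<n next≡v next-loses = kthHighest-++-by-counts own comp above≤K'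
    (ℕP.<-trans (ℕP.n<1+n K') (ℕP.<-≤-trans (ℕP.≰⇒> next-loses)
      (ℕP.+-mono-≤ (index<count-atLeast desc next<n next≡v)
                   (count-mono (above? v) (atLeast? v) ℚP.<⇒≤ comp))))

  kthHighest-beyond-K : x' < length own → K' ≤ x' → kthHighest (suc K') (own ++ comp) ≡ v
  kthHighest-beyond-K x'<n K'≤x' = kthHighest-++-by-counts own comp above≤K'
    (ℕP.<-≤-trans (s≤s K'≤x') (ℕP.≤-trans (x'<atLeast-own x'<n) (ℕP.m≤m+n _ _)))

  kthHighest-within-K : x' < length own →
    (suc x' < length own → ¬ Wins (suc K') comp (suc (suc x')) (nth (suc x') own)) →
    ∀ r → suc x' + r ≡ K' → r < length comp → kthHighest (suc K') (own ++ comp) ≡ v ℚ.⊓ nth r (sortDesc comp)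
  kthHighest-within-K x'<n next-loses r refl r<n with nth r (sortDesc comp) ℚP.≤? v
  ... | yes d≤v rewrite ℚP.p≥q⇒p⊓q≡q d≤v = kthHighest-++-by-counts own comp
    (ℕP.+-mono-≤ (count≤index (above? d) ℚP.<-≤-trans desc (suc x') next-not-above)
                 (numAbove-nth-sortDesc≤ comp r))
    (ℕP.<-≤-trans (ℕP.+-monoʳ-< (suc x') (ℕP.n<1+n r))
      (ℕP.+-mono-≤ (index<count (atLeast? d) ℚP.≤-trans desc x'<n (subst (d ℚ.≤_) (sym last≡v) d≤v))
                   (<count-atLeast-nth-sortDesc comp r<n)))
    where
    d : ℚ
    d = nth r (sortDesc comp)
    -- An own bid above d would face at most r higher competing bids and so would also win.
    next-not-above : suc x' < length own → ¬ (d ℚ.< nth (suc x') own)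
    next-not-above next<n d<next = next-loses next<n (ℕP.+-monoʳ-≤ (suc (suc x'))
      (ℕP.≤-trans (numAbove-antitone comp (ℚP.<⇒≤ d<next)) (numAbove-nth-sortDesc≤ comp r)))
  ... | no d≰v rewrite ℚP.p≤q⇒p⊓q≡p (ℚP.<⇒≤ (ℚP.≰⇒> d≰v)) = kthHighest-++-by-counts own comp above≤K'
    (ℕP.<-≤-trans (ℕP.+-monoʳ-< (suc x') (ℕP.n<1+n r))
      (ℕP.+-mono-≤ (x'<atLeast-own x'<n)
        (ℕP.≤-trans (<count-atLeast-nth-sortDesc comp r<n)
          (count-mono (atLeast? _) (atLeast? v) (ℚP.≤-trans (ℚP.<⇒≤ (ℚP.≰⇒> d≰v))) comp))))

  kthHighest-boundary : suc K' ≤ length comp → x' < length own →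
    (suc x' < length own → ¬ Wins (suc K') comp (suc (suc x')) (nth (suc x') own)) →
    fin (kthHighest (suc K') (own ++ comp)) ≡ min∞ (fin v) (compMinus (suc K') comp (suc x' + 1))
  kthHighest-boundary K≤n x'<n next-loses with suc x' + 1 ℕ.≤? suc K'
  ... | no beyond =
    cong fin (kthHighest-beyond-K x'<n (ℕP.≤-pred (subst (suc K' ≤_) (ℕP.+-comm x' 1) (ℕP.≤-pred (ℕP.≰⇒> beyond)))))
  ... | yes within =
    cong fin (kthHighest-within-K x'<n next-loses (K' ∸ (x' + 1))
      (trans (cong (_+ (K' ∸ (x' + 1))) (ℕP.+-comm 1 x')) (ℕP.m+[n∸m]≡n (ℕP.≤-pred within)))
      (ℕP.<-≤-trans (s≤s (ℕP.m∸n≤m K' (x' + 1))) K≤n))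

module _ (comp : List ℚ) {own : List ℚ} (desc : Descending own) {x' : ℕ} {v : ℚ}
         (last≡v : nth x' own ≡ v) where

  private
    last-wins : ∀ {K} → allocation K own comp ≡ suc x' → Wins K comp (suc x') v
    last-wins x≡1+x' = subst (Wins _ comp (suc x')) last≡v (winsFrom-last-wins desc 1 x' x≡1+x')

    next-loses : ∀ {K} → allocation K own comp ≡ suc x' →
                 suc x' < length own → ¬ Wins K comp (suc (suc x')) (nth (suc x') own)
    next-loses {K} x≡1+x' next<n = subst (λ w → ¬ Wins K comp (suc w) (nth w own)) x≡1+x'
      (winsFrom-next-loses desc 1 (subst (_< length own) (sym x≡1+x') next<n))

  price-interior : ∀ K → allocation K own comp ≡ suc x' → suc x' < length own → nth (suc x') own ≡ v →
                   price K own comp ≡ v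
  price-interior zero     x≡1+x' _ _ with () ← last-wins x≡1+x'
  price-interior (suc K') x≡1+x' next<n next≡v = trans (price-of-win (suc K') own comp x≡1+x')
    (kthHighest-interior comp desc last≡v (last-wins x≡1+x') next<n next≡v
      (subst (¬_ ∘ Wins (suc K') comp (suc (suc x'))) next≡v (next-loses x≡1+x' next<n)))

  price-boundary : ∀ K → allocation K own comp ≡ suc x' → K ≤ length comp →
                   fin (price K own comp) ≡ min∞ (fin v) (compMinus K comp (suc x' + 1))
  price-boundary zero     x≡1+x' _ with () ← last-wins x≡1+x'
  price-boundary (suc K') x≡1+x' K≤n = trans (cong fin (price-of-win (suc K') own comp x≡1+x'))
    (kthHighest-boundary comp desc last≡v (last-wins x≡1+x') K≤n x'<length (next-loses x≡1+x'))
    where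
    x'<length : x' < length own
    x'<length = subst (_≤ length own) x≡1+x' (winsFrom≤length 1 own)

mainTheorem14 : (K : ℕ) (comp : List ℚ) → K ≤ length comp →
    (m : ℕ) (b : Fin m → ℚ) (q : Fin m → ℕ) →
    (∀ j → 0ℚ ℚ.< b j) → StrictlyDecreasing b → (∀ j → 1 ≤ q j) →
    (allocation K (bidVector b q) comp ≡ 0 → price K (bidVector b q) comp ≡ 0ℚ)
    × (∀ (ℓ : Fin m) →
         Qsum q (toℕ ℓ) < allocation K (bidVector b q) comp →
         allocation K (bidVector b q) comp < Qsum q (suc (toℕ ℓ)) →
         price K (bidVector b q) comp ≡ b ℓ)
    × (∀ (ℓ : Fin m) →
         allocation K (bidVector b q) comp ≡ Qsum q (suc (toℕ ℓ)) →
         fin (price K (bidVector b q) comp)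
           ≡ min∞ (fin (b ℓ)) (compMinus K comp (Qsum q (suc (toℕ ℓ)) + 1)))
mainTheorem14 K comp K≤n m b q _ b↓ q≥1 =
  price-of-no-win K own comp , (λ ℓ → inside ℓ refl) , (λ ℓ x≡Q → at-boundary ℓ x≡Q refl)
  where
  own : List ℚ
  own = bidVector b q

  desc : Descending own
  desc = bidVector-descending b q b↓

  inside : ∀ ℓ {x} → allocation K own comp ≡ x →
           Qsum q (toℕ ℓ) < x → x < Qsum q (suc (toℕ ℓ)) → price K own comp ≡ b ℓ
  inside ℓ {suc x'} x≡1+x' Q<x x<Q′ =
    price-interior comp desc (nth-bidVector-block b q ℓ (ℕP.≤-pred Q<x) (ℕP.<-trans (ℕP.n<1+n x') x<Q′))
      K x≡1+x' (ℕP.<-≤-trans x<Q′ (Qsum≤length-bidVector b q ℓ)) (nth-bidVector-block b q ℓ (ℕP.<⇒≤ Q<x) x<Q′)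

  at-boundary : ∀ ℓ {x} → allocation K own comp ≡ x → x ≡ Qsum q (suc (toℕ ℓ)) →
                fin (price K own comp) ≡ min∞ (fin (b ℓ)) (compMinus K comp (x + 1))
  at-boundary ℓ {zero} _ 0≡Q = contradiction (subst (Qsum q (toℕ ℓ) <_) (sym 0≡Q) (Qsum<Qsum-suc q q≥1 ℓ)) λ ()
  at-boundary ℓ {suc x'} x≡1+x' 1+x'≡Q = price-boundary comp desc last≡bℓ K x≡1+x' K≤n
    where
    last≡bℓ : nth x' own ≡ b ℓ
    last≡bℓ = nth-bidVector-block b q ℓ
      (ℕP.≤-pred (subst (Qsum q (toℕ ℓ) <_) (sym 1+x'≡Q) (Qsum<Qsum-suc q q≥1 ℓ)))
      (subst (x' <_) 1+x'≡Q (ℕP.n<1+n x'))
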